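{- Let $n\ge1$, $i,j\in\{ -n-1,\dots,n+1\}$ and $R_i$ as in the context. If $|j|>|i|$ then $R_i\circ R_j=R_j$.
   Context: For $p=(p_1,\dots,p_n)\in\mathbb Q^n$: $(p,q)\in L_1$ iff $p_1<q_1$; for $2\le i\le n$, $(p,q)\in L_i$ iff $(p_1,\dots,p_{i-1})=(q_1,\dots,q_{i-1})$ and $p_i<q_i$. Let $<_n=L_1\cup\dots\cup L_n$. $X=\mathbb Q^n\times\{ -1,1\}$, writing $p^b$ for $(p,b)$, with $p^b\le_X q^d$ iff $p^b=q^d$ or $p<_nq$; $\alpha(p^b)=p^{ -b}$. For $R\subseteq X^2$, $R^c=X^2\setminus R$, $R^\smile$ the converse, $\circ$ relational composition. $U_j=\{(p^b,q^d)\mid b,d\in\{ -1,1\},(p,q)\in L_j\}$. $R_{ -n-1}=\varnothing$; $R_i=\bigcup_{j=1}^{n+1+i}U_j$ for $-n\le i\le-1$; $R_0={\le_X}$; $R_i=(R_{ -i})^{c\smile}\circ\alpha$ for $1\le i\le n+1$. -}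

module Defs where

open import Data.Nat using (ℕ; zero; suc; _+_; _≤_; _<_)
open import Data.Integer using (ℤ; +_; -[1+_])
open import Data.Fin using (Fin; toℕ)
open import Data.Vec using (Vec; lookup)
open import Data.Rational using (ℚ) renaming (_<_ to _<ℚ_)
open import Data.Sign using (Sign; opposite)
open import Data.Product using (Σ; ∃; _×_; _,_; proj₁)
open import Data.Sum using (_⊎_)
open import Relation.Nullary using (¬_)
open import Relation.Binary.PropositionalEquality using (_≡_)

Pt : ℕ → Set
Pt n = Vec ℚ n

X : ℕ → Set
X n = Pt n × Sign

Rl : Set → Set₁
Rl A = A → A → Set

_ᶜ : {A : Set} → Rl A → Rl A
(R ᶜ) x y = ¬ R x y

_˘ : {A : Set} → Rl A → Rl A
(R ˘) x y = R y x

_⨾_ : {A : Set} → Rl A → Rl A → Rl A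
(R ⨾ S) x z = ∃ λ y → R x y × S y z

graph : {A : Set} → (A → A) → Rl A
graph f x y = f x ≡ y

_≐_ : {A : Set} → Rl A → Rl A → Set
R ≐ S = (∀ x y → R x y → S x y) × (∀ x y → S x y → R x y)

-- L_{j+1} for j : Fin n (0-based index): first j coordinates agree, coordinate j strictly smaller
L : {n : ℕ} → Fin n → Rl (Pt n)
L j p q = (∀ (m : Fin _) → toℕ m < toℕ j → lookup p m ≡ lookup q m) × (lookup p j <ℚ lookup q j)

_<ₙ_ : {n : ℕ} → Rl (Pt n)
p <ₙ q = ∃ λ j → L j p q

≤X : {n : ℕ} → Rl (X n)
≤X x y = x ≡ y ⊎ (proj₁ x <ₙ proj₁ y)

α : {n : ℕ} → X n → X n
α (p , b) = p , opposite b

U : {n : ℕ} → Fin n → Rl (X n)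
U j x y = L j (proj₁ x) (proj₁ y)

-- Rneg k = R_{-k} for 0 ≤ k ≤ n+1:
--   R_0 = ≤_X ;  R_{-k} = ⋃_{j=1}^{n+1-k} U_j  (empty union = ∅ when k = n+1)
Rneg : (n : ℕ) → ℕ → Rl (X n)
Rneg n zero = ≤X
Rneg n (suc k) x y = ∃ λ (j : Fin n) → (toℕ j + suc k ≤ n) × U j x y

-- R_i for i ∈ ℤ (only meaningful for -n-1 ≤ i ≤ n+1)
R : (n : ℕ) → ℤ → Rl (X n)
R n (+ zero) = Rneg n zero
R n (+ suc k) = ((Rneg n (suc k)) ᶜ ˘) ⨾ graph α
R n -[1+ k ] = Rneg n (suc k)

-- For b ≥ 1 the relation R_{-b} relates p^s to q^t exactly when the first n + 1 − b coordinates of p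
-- are lexicographically below those of q, and, α being an involution, R_b is the complement of the
-- converse of R_{-b}: the total preorder ≤_b of the same truncated lexicographic order. Let b = |j|.
-- Whenever |i| < b, R_i is contained in ≤_b, and R_j absorbs ≤_b from the left, so R_i ⨾ R_j ⊆ R_j.
-- Conversely every x has an R_i-successor y with y ≤_b x: take y = x when i ≥ 0 (R_i is then
-- reflexive), and for i = −a < 0 raise the (n + 2 − b)-th coordinate of x, which R_{-a} sees but ≤_b ignores.
module Submission where

open import Defs
open import Data.Nat using (ℕ; zero; suc; _+_; _∸_; _≤_; _<_; _≤?_; z≤n; s≤s)
open import Data.Nat.Properties
  using (≤-refl; ≤-trans; <-irrefl; <⇒≤; ≤-<-trans; <-≤-trans; ≰⇒>; <-cmp; +-monoˡ-≤; +-monoʳ-≤;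
         +-cancelʳ-<; +-suc; ∸-monoʳ-<; m∸n+n≡m; n<1+n)
open import Data.Integer using (ℤ; ∣_∣; -[1+_]; +≤+; -≤-) renaming (_≤_ to _≤ℤ_; -_ to -ℤ_; +_ to +ℤ_)
open import Data.Fin using (Fin; toℕ; fromℕ<) renaming (zero to fzero; suc to fsuc)
open import Data.Fin.Properties using (toℕ-injective; toℕ-fromℕ<)
open import Data.Vec using (lookup; updateAt; _∷_; [])
open import Data.Vec.Properties using (lookup∘updateAt; lookup∘updateAt′)
open import Data.Rational using (ℚ; 1ℚ) renaming (_+_ to _+ℚ_; _<_ to _<ℚ_)
import Data.Rational.Properties as ℚ
open import Data.Sign.Properties using (opposite-involutive)
open import Data.Product using (∃; _×_; _,_; proj₁)
open import Data.Sum using (_⊎_; inj₁; inj₂)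
open import Function using (_∘_)
open import Relation.Nullary using (¬_; yes; no; contradiction)
open import Relation.Binary using (tri<; tri≈; tri>)
open import Relation.Binary.PropositionalEquality using (_≡_; refl; sym; trans; cong; subst)

⨾-≐-right-absorbing : {A : Set} {P Q T : Rl A}
  → (∀ x y → P x y → T x y)
  → (∀ x → ∃ λ y → P x y × T y x)
  → (∀ {x y z} → T x y → Q y z → Q x z)
  → (P ⨾ Q) ≐ Q
⨾-≐-right-absorbing P⊆T section T⨾Q⊆Q =
    (λ { x z (y , Pxy , Qyz) → T⨾Q⊆Q (P⊆T x y Pxy) Qyz })
  , (λ x z Qxz → let (y , Pxy , Tyx) = section x in y , Pxy , T⨾Q⊆Q Tyx Qxz)

-m≤i≤m⇒∣i∣≤m : ∀ {m} i → -ℤ (+ℤ m) ≤ℤ i → i ≤ℤ +ℤ m → ∣ i ∣ ≤ m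
-m≤i≤m⇒∣i∣≤m (+ℤ k) _ (+≤+ k≤m) = k≤m
-m≤i≤m⇒∣i∣≤m {suc m} -[1+ k ] (-≤- k≤m) _ = s≤s k≤m

L-there : ∀ {n} {j : Fin n} {p q : Pt n} (a : ℚ) → L j p q → L (fsuc j) (a ∷ p) (a ∷ q)
L-there _ (eq , lt) = (λ { fzero _ → refl ; (fsuc m) (s≤s m<j) → eq m m<j }) , lt

L-trichotomy : ∀ {n} (p q : Pt n) → p ≡ q ⊎ ∃ λ j → L j p q ⊎ L j q p
L-trichotomy [] [] = inj₁ refl
L-trichotomy (a ∷ p) (b ∷ q) with ℚ.<-cmp a b
... | tri< a<b _ _ = inj₂ (fzero , inj₁ ((λ _ ()) , a<b))
... | tri> _ _ b<a = inj₂ (fzero , inj₂ ((λ _ ()) , b<a))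
... | tri≈ _ refl _ with L-trichotomy p q
...   | inj₁ refl = inj₁ refl
...   | inj₂ (j , inj₁ l) = inj₂ (fsuc j , inj₁ (L-there a l))
...   | inj₂ (j , inj₂ l) = inj₂ (fsuc j , inj₂ (L-there a l))

module _ {n : ℕ} where

  L-irrefl : ∀ {j} {p : Pt n} → ¬ L j p p
  L-irrefl (_ , lt) = ℚ.<-irrefl refl lt

  L-trans : ∀ {i j} {p q r : Pt n} → L i p q → L j q r →
            ∃ λ k → toℕ k ≤ toℕ i × toℕ k ≤ toℕ j × L k p r
  L-trans {i} {j} (eq₁ , lt₁) (eq₂ , lt₂) with <-cmp (toℕ i) (toℕ j)
  ... | tri< i<j _ _ = i , ≤-refl , <⇒≤ i<j ,
        (λ m m<i → trans (eq₁ m m<i) (eq₂ m (<-≤-trans m<i (<⇒≤ i<j)))) ,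
        ℚ.<-respʳ-≡ (eq₂ i i<j) lt₁
  ... | tri> _ _ j<i = j , <⇒≤ j<i , ≤-refl ,
        (λ m m<j → trans (eq₁ m (<-≤-trans m<j (<⇒≤ j<i))) (eq₂ m m<j)) ,
        ℚ.<-respˡ-≡ (sym (eq₁ j j<i)) lt₂
  ... | tri≈ _ i≡j _ with toℕ-injective i≡j
  ...   | refl = i , ≤-refl , ≤-refl , (λ m m<i → trans (eq₁ m m<i) (eq₂ m m<i)) , ℚ.<-trans lt₁ lt₂

  -- p <[ b ] q: p is lexicographically below q on the first n + 1 − b coordinates. This is the
  -- Σ-type underlying Rneg n b, wrapped in a record so that unification can recover p and q.
  record _<[_]_ (p : Pt n) (b : ℕ) (q : Pt n) : Set where
    constructor lex
    field
      {index} : Fin n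
      index-visible : toℕ index + b ≤ n
      differs : L index p q

  _≤[_]_ : Pt n → ℕ → Pt n → Set
  p ≤[ b ] q = ¬ (q <[ b ] p)

  _≈[_]_ : Pt n → ℕ → Pt n → Set
  p ≈[ b ] q = ∀ (m : Fin n) → toℕ m + b ≤ n → lookup p m ≡ lookup q m

  ≈[]-sym : ∀ {b} {p q : Pt n} → p ≈[ b ] q → q ≈[ b ] p
  ≈[]-sym p≈q m h = sym (p≈q m h)

  level-lower : ∀ {b} {j k : Fin n} → toℕ k ≤ toℕ j → toℕ j + b ≤ n → toℕ k + b ≤ n
  level-lower {b} k≤j = ≤-trans (+-monoˡ-≤ b k≤j)

  <[]-irrefl : ∀ {b} {p : Pt n} → ¬ p <[ b ] p
  <[]-irrefl {p = p} (lex _ l) = L-irrefl {p = p} l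

  <[]-trans : ∀ {b} {p q r : Pt n} → p <[ b ] q → q <[ b ] r → p <[ b ] r
  <[]-trans {p = p} {q} {r} (lex hi l₁) (lex _ l₂) with L-trans {p = p} {q} {r} l₁ l₂
  ... | _ , k≤i , _ , l = lex (level-lower k≤i hi) l

  <[]-respˡ-≈[] : ∀ {b} {p q r : Pt n} → p ≈[ b ] q → q <[ b ] r → p <[ b ] r
  <[]-respˡ-≈[] p≈q (lex {j} h (eq , lt)) =
    lex h ( (λ m m<j → trans (p≈q m (level-lower (<⇒≤ m<j) h)) (eq m m<j))
          , ℚ.<-respˡ-≡ (sym (p≈q j h)) lt)

  <[]-respʳ-≈[] : ∀ {b} {p q r : Pt n} → p <[ b ] q → q ≈[ b ] r → p <[ b ] r
  <[]-respʳ-≈[] (lex {j} h (eq , lt)) q≈r =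
    lex h ( (λ m m<j → trans (eq m m<j) (q≈r m (level-lower (<⇒≤ m<j) h)))
          , ℚ.<-respʳ-≡ (q≈r j h) lt)

  -- A first difference at a coordinate beyond level b is invisible at that level.
  L⇒<[]⊎≈[] : ∀ {b j} {p q : Pt n} → L j p q → p <[ b ] q ⊎ p ≈[ b ] q
  L⇒<[]⊎≈[] {b} {j} l@(eq , _) with toℕ j + b ≤? n
  ... | yes h = inj₁ (lex h l)
  ... | no h = inj₂ (λ m hm → eq m (+-cancelʳ-< b (toℕ m) (toℕ j) (≤-<-trans hm (≰⇒> h))))

  <[]-trichotomy : ∀ b (p q : Pt n) → p <[ b ] q ⊎ p ≈[ b ] q ⊎ q <[ b ] p
  <[]-trichotomy b p q with L-trichotomy p q
  ... | inj₁ refl = inj₂ (inj₁ λ _ _ → refl)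
  ... | inj₂ (j , inj₁ l) with L⇒<[]⊎≈[] {b} l
  ...   | inj₁ p<q = inj₁ p<q
  ...   | inj₂ p≈q = inj₂ (inj₁ p≈q)
  <[]-trichotomy b p q | inj₂ (j , inj₂ l) with L⇒<[]⊎≈[] {b} l
  ...   | inj₁ q<p = inj₂ (inj₂ q<p)
  ...   | inj₂ q≈p = inj₂ (inj₁ (≈[]-sym {p = q} {p} q≈p))

  ≤[]-refl : ∀ {b} {p : Pt n} → p ≤[ b ] p
  ≤[]-refl = <[]-irrefl

  ≈[]⇒≤[] : ∀ {b} {p q : Pt n} → p ≈[ b ] q → p ≤[ b ] q
  ≈[]⇒≤[] p≈q q<p = <[]-irrefl (<[]-respʳ-≈[] q<p p≈q)

  <ₙ⇒≤[] : ∀ {b} {p q : Pt n} → p <ₙ q → p ≤[ b ] q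
  <ₙ⇒≤[] {p = p} {q} (_ , l₁) (lex _ l₂) =
    let (_ , _ , _ , l) = L-trans {p = p} {q} {p} l₁ l₂ in L-irrefl {p = p} l

  ≤[]-mono : ∀ {a b} {p q : Pt n} → a ≤ b → p ≤[ a ] q → p ≤[ b ] q
  ≤[]-mono {a} a≤b p≤q (lex {j} h l) = p≤q (lex (≤-trans (+-monoʳ-≤ (toℕ j) a≤b) h) l)

  ≤[]-<[]-trans : ∀ {b} {p q r : Pt n} → p ≤[ b ] q → q <[ b ] r → p <[ b ] r
  ≤[]-<[]-trans {b} {p} {q} p≤q q<r with <[]-trichotomy b p q
  ... | inj₁ p<q = <[]-trans p<q q<r
  ... | inj₂ (inj₁ p≈q) = <[]-respˡ-≈[] p≈q q<r
  ... | inj₂ (inj₂ q<p) = contradiction q<p p≤q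

  <[]-≤[]-trans : ∀ {b} {p q r : Pt n} → p <[ b ] q → q ≤[ b ] r → p <[ b ] r
  <[]-≤[]-trans {b} {p} {q} {r} p<q q≤r with <[]-trichotomy b q r
  ... | inj₁ q<r = <[]-trans p<q q<r
  ... | inj₂ (inj₁ q≈r) = <[]-respʳ-≈[] p<q q≈r
  ... | inj₂ (inj₂ r<q) = contradiction r<q q≤r

  ≤[]-trans : ∀ {b} {p q r : Pt n} → p ≤[ b ] q → q ≤[ b ] r → p ≤[ b ] r
  ≤[]-trans p≤q q≤r r<p = q≤r (<[]-≤[]-trans r<p p≤q)

  p<p+1 : ∀ p → p <ℚ p +ℚ 1ℚ
  p<p+1 p = subst (_<ℚ p +ℚ 1ℚ) (ℚ.+-identityʳ p) (ℚ.+-monoʳ-< p (ℚ.positive⁻¹ 1ℚ))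

  raise : Fin n → Pt n → Pt n
  raise d p = updateAt p d (_+ℚ 1ℚ)

  L-raise : ∀ d (p : Pt n) → L d p (raise d p)
  L-raise d p =
      (λ m m<d → sym (lookup∘updateAt′ m d (λ { refl → <-irrefl refl m<d }) p))
    , subst (lookup p d <ℚ_) (sym (lookup∘updateAt d p)) (p<p+1 (lookup p d))

  raise-≈[] : ∀ {b} d (p : Pt n) → n < toℕ d + b → raise d p ≈[ b ] p
  raise-≈[] d p n<d+b m m+b≤n = lookup∘updateAt′ m d (λ { refl → <-irrefl refl (<-≤-trans n<d+b m+b≤n) }) p

  -- The coordinate d = n − k is the last one seen at level k and the first one ignored at level k + 1.
  <[]-≈[]-witness : ∀ {a k} → a < k → k ≤ n → (p : Pt n) → ∃ λ q → p <[ suc a ] q × q ≈[ suc k ] p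
  <[]-≈[]-witness {a} {k} a<k k≤n p =
    raise d p , lex d+a<n (L-raise d p) , raise-≈[] d p n<d+k+1
    where
    n∸k<n : n ∸ k < n
    n∸k<n = ∸-monoʳ-< (<-≤-trans (s≤s z≤n) a<k) k≤n
    d : Fin n
    d = fromℕ< n∸k<n
    d+k≡n : toℕ d + k ≡ n
    d+k≡n = trans (cong (_+ k) (toℕ-fromℕ< n∸k<n)) (m∸n+n≡m k≤n)
    d+a<n : toℕ d + suc a ≤ n
    d+a<n = subst (toℕ d + suc a ≤_) d+k≡n (+-monoʳ-≤ (toℕ d) a<k)
    n<d+k+1 : n < toℕ d + suc k
    n<d+k+1 = subst (n <_) (sym (trans (+-suc (toℕ d) k) (cong suc d+k≡n))) (n<1+n n)

  α-involutive : (x : X n) → α (α x) ≡ x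
  α-involutive (p , s) = cong (p ,_) (opposite-involutive s)

  R-neg⇒<[] : ∀ {k} (x y : X n) → R n -[1+ k ] x y → proj₁ x <[ suc k ] proj₁ y
  R-neg⇒<[] _ _ (_ , h , l) = lex h l

  <[]⇒R-neg : ∀ {k} (x y : X n) → proj₁ x <[ suc k ] proj₁ y → R n -[1+ k ] x y
  <[]⇒R-neg _ _ (lex h l) = _ , h , l

  R-suc⇒≤[] : ∀ {k} (x y : X n) → R n (+ℤ suc k) x y → proj₁ x ≤[ suc k ] proj₁ y
  R-suc⇒≤[] x y (_ , y≮x , refl) = y≮x ∘ <[]⇒R-neg y x

  ≤[]⇒R-suc : ∀ {k} (x y : X n) → proj₁ x ≤[ suc k ] proj₁ y → R n (+ℤ suc k) x y
  ≤[]⇒R-suc x y x≤y = α y , x≤y ∘ R-neg⇒<[] y x , α-involutive y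

  R⊆≤[] : ∀ i {b} → ∣ i ∣ < b → (x y : X n) → R n i x y → proj₁ x ≤[ b ] proj₁ y
  R⊆≤[] (+ℤ zero) _ x y (inj₁ refl) = ≤[]-refl
  R⊆≤[] (+ℤ zero) _ x y (inj₂ x<y) = <ₙ⇒≤[] x<y
  R⊆≤[] (+ℤ suc a) a<b x y xRy = ≤[]-mono (<⇒≤ a<b) (R-suc⇒≤[] x y xRy)
  R⊆≤[] -[1+ a ] _ x y (j , _ , l) = <ₙ⇒≤[] (j , l)

  R-≤[]-section : ∀ i {b} → ∣ i ∣ < b → b ≤ suc n → (x : X n) → ∃ λ y → R n i x y × proj₁ y ≤[ b ] proj₁ x
  R-≤[]-section (+ℤ zero) _ _ x = x , inj₁ refl , ≤[]-refl
  R-≤[]-section (+ℤ suc a) _ _ x = x , ≤[]⇒R-suc x x ≤[]-refl , ≤[]-refl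
  R-≤[]-section -[1+ a ] (s≤s a<k) (s≤s k≤n) (p , s) with <[]-≈[]-witness a<k k≤n p
  ... | q , p<q , q≈p = (q , s) , <[]⇒R-neg (p , s) (q , s) p<q , ≈[]⇒≤[] q≈p

  ≤[]-R-trans : ∀ j → 0 < ∣ j ∣ → {x y z : X n} → proj₁ x ≤[ ∣ j ∣ ] proj₁ y → R n j y z → R n j x z
  ≤[]-R-trans (+ℤ suc k) _ {x} {y} {z} x≤y yRz = ≤[]⇒R-suc x z (≤[]-trans x≤y (R-suc⇒≤[] y z yRz))
  ≤[]-R-trans -[1+ k ] _ {x} {y} {z} x≤y y<z = <[]⇒R-neg x z (≤[]-<[]-trans x≤y (R-neg⇒<[] y z y<z))

lemma3p8 : (n : ℕ) → 1 ≤ n → (i j : ℤ)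
    → -ℤ (+ℤ (suc n)) ≤ℤ i → i ≤ℤ +ℤ (suc n)
    → -ℤ (+ℤ (suc n)) ≤ℤ j → j ≤ℤ +ℤ (suc n)
    → ∣ i ∣ < ∣ j ∣
    → (R n i ⨾ R n j) ≐ R n j
lemma3p8 n _ i j _ _ -n-1≤j j≤n+1 ∣i∣<∣j∣ =
  ⨾-≐-right-absorbing
    (R⊆≤[] i ∣i∣<∣j∣)
    (R-≤[]-section i ∣i∣<∣j∣ (-m≤i≤m⇒∣i∣≤m j -n-1≤j j≤n+1))
    (≤[]-R-trans j (≤-<-trans z≤n ∣i∣<∣j∣))
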